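{- Let $G=(V,E)$ be a directed acyclic graph with $V=\{v_1,\dots,v_n\}$ listed in a topological order, and let $E=E_1\cup E_2$ be an edge split of $G$. Let $u,v\in V$, and for $1\le i\le n$ let $\mathcal{P}_i$ be the family of all paths from $u$ to $v_i$ using only edges of $E_1$, $\mathcal{Q}_i$ the family of all paths from $v_i$ to $v$ using only edges of $E_2$, and $\mathcal{S}$ the family of all paths from $u$ to $v$ in $G$. Let $X=\bigoplus_{i=1}^{n}\big(\mathrm{repr}_L(\mathcal{P}_i)\otimes\mathrm{repr}_R(\mathcal{Q}_i)\big)$. Then: (a) $X=(\bot,\bot)$ if and only if $\mathrm{repr}(\mathcal{S})=\mathbb{U}$; (b) if $X=(e_1,\top)$ with $e_1\in E$ then $e_1\in\mathrm{repr}(\mathcal{S})$; (c) if $X=(\top,e_2)$ with $e_2\in E$ then $e_2\in\mathrm{repr}(\mathcal{S})$; (d) if $X=(e_1,e_2)$ with $e_1,e_2\in E$ then $e_1,e_2\in\mathrm{repr}(\mathcal{S})$; (e) $X=(\top,\top)$ if and only if $\mathrm{repr}(\mathcal{S})=\emptyset$.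
   Context: A path is a sequence of vertices $w_1,\dots,w_k$ with $(w_j,w_{j+1})\in E$ for all $j$; it is identified with its set of edges, and for every vertex there is a path of length $0$ from it to itself. An edge split of $G$ is a partition $E=E_1\cup E_2$ such that there are no vertices $x,y,z$ with $(x,y)\in E_2$ and $(y,z)\in E_1$. Let $E^+=E\cup\{\top,\bot\}$ with $\top,\bot$ new symbols. For a family $\mathcal{P}$ of paths with common endpoints: $\mathrm{repr}(\mathcal{P})$ is the set of edges contained in every path of $\mathcal{P}$ if $\mathcal{P}\neq\emptyset$, and $\mathrm{repr}(\emptyset)=\mathbb{U}$, a special symbol (the top element, "universe"). $\mathrm{repr}_L(\mathcal{P})=\bot$ if $\mathcal{P}=\emptyset$, $=\top$ if $\mathcal{P}\neq\emptyset$ and no edge lies on all its paths, and otherwise is the edge lying on all paths of $\mathcal{P}$ whose tail is minimum in the topological order; $\mathrm{repr}_R$ is the same with "maximum". Operations: for $a,b\in E^+$, $a\otimes b=(\bot,\bot)$ if $a=\bot$ or $b=\bot$, and $a\otimes b=(a,b)$ otherwise. On $E^+$: $a\oplus\bot=\bot\oplus a=a$, $a\oplus\top=\top\oplus a=\top$, and for $e,e'\in E$: $e\oplus e'=e$ if $e=e'$ and $e\oplus e'=\top$ if $e\ne e'$. On pairs, $(a_1,b_1)\oplus(a_2,b_2)=(a_1\oplus a_2,b_1\oplus b_2)$; $\bigoplus$ denotes the iterated operation (which is associative and commutative). -}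

module Defs where

open import Data.Nat using (ℕ)
open import Data.Fin using (Fin; _<_; _≤_; _≟_)
open import Data.Bool using (Bool; true; false; _∧_; not)
open import Data.Product using (_×_; _,_; Σ; ∃)
open import Data.Sum using (_⊎_)
open import Data.Empty using (⊥)
open import Data.List using (List; foldr; map; allFin)
open import Relation.Nullary using (¬_; yes; no)
open import Relation.Binary.PropositionalEquality using (_≡_)

-- A (directed) graph on the vertex set V = Fin n, given by its edge relation.
-- Vertices v_1,...,v_n are the elements of Fin n in their natural order.
Graph : ℕ → Set
Graph n = Fin n → Fin n → Bool

module _ {n : ℕ} where

  -- V = {v_1,...,v_n} is listed in a topological order: every edge goes forward.
  -- (This also makes G acyclic.)
  TopologicalOrder : Graph n → Set
  TopologicalOrder E = ∀ x y → E x y ≡ true → x < y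

  SubGraph : Graph n → Graph n → Set
  SubGraph E₁ E = ∀ x y → E₁ x y ≡ true → E x y ≡ true

  -- E₂ = E \ E₁, so that E = E₁ ∪ E₂ is a partition
  complement : Graph n → Graph n → Graph n
  complement E E₁ x y = E x y ∧ not (E₁ x y)

  IsEdgeSplit : Graph n → Graph n → Set
  IsEdgeSplit E E₁ = SubGraph E₁ E ×
    (∀ x y z → complement E E₁ x y ≡ true → E₁ y z ≡ true → ⊥)

  data Path (H : Graph n) : Fin n → Fin n → Set where
    here : ∀ {a} → Path H a a
    step : ∀ {a b c} → H a b ≡ true → Path H b c → Path H a c

  OnPath : ∀ {H a b} → Fin n → Fin n → Path H a b → Set
  OnPath x y here = ⊥
  OnPath x y (step {a} {b} _ p) = (x ≡ a × y ≡ b) ⊎ OnPath x y p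

  OnAll : Graph n → Fin n → Fin n → Fin n → Fin n → Set
  OnAll H a b x y = ∀ (p : Path H a b) → OnPath x y p

  -- repr(S) = 𝕌  (the family is empty)
  ReprIsUniverse : Graph n → Fin n → Fin n → Set
  ReprIsUniverse H a b = ¬ Path H a b

  -- e = (x,y) ∈ repr(S)  (the family is nonempty and e lies on all its paths)
  InRepr : Graph n → Fin n → Fin n → Fin n → Fin n → Set
  InRepr H a b x y = Path H a b × OnAll H a b x y

  -- repr(S) = ∅  (the family is nonempty and no edge lies on all its paths)
  ReprIsEmpty : Graph n → Fin n → Fin n → Set
  ReprIsEmpty H a b = Path H a b × (∀ x y → ¬ OnAll H a b x y)

  data E⁺ : Set where
    top : E⁺
    bot : E⁺
    edge : Fin n → Fin n → E⁺

  IsReprL : Graph n → Fin n → Fin n → E⁺ → Set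
  IsReprL H a b bot = ¬ Path H a b
  IsReprL H a b top = Path H a b × (∀ x y → ¬ OnAll H a b x y)
  IsReprL H a b (edge x y) = Path H a b × OnAll H a b x y ×
    (∀ x' y' → OnAll H a b x' y' → x ≤ x')

  IsReprR : Graph n → Fin n → Fin n → E⁺ → Set
  IsReprR H a b bot = ¬ Path H a b
  IsReprR H a b top = Path H a b × (∀ x y → ¬ OnAll H a b x y)
  IsReprR H a b (edge x y) = Path H a b × OnAll H a b x y ×
    (∀ x' y' → OnAll H a b x' y' → x' ≤ x)

  _⊗_ : E⁺ → E⁺ → E⁺ × E⁺
  bot ⊗ b = bot , bot
  a ⊗ bot = bot , bot
  a ⊗ b = a , b

  _⊕_ : E⁺ → E⁺ → E⁺
  a ⊕ bot = a
  bot ⊕ b = b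
  top ⊕ b = top
  a ⊕ top = top
  edge x y ⊕ edge x' y' with x ≟ x' | y ≟ y'
  ... | yes _ | yes _ = edge x y
  ... | _ | _ = top

  _⊕₂_ : E⁺ × E⁺ → E⁺ × E⁺ → E⁺ × E⁺
  (a₁ , b₁) ⊕₂ (a₂ , b₂) = (a₁ ⊕ a₂) , (b₁ ⊕ b₂)

  ⨁ : (Fin n → E⁺ × E⁺) → E⁺ × E⁺
  ⨁ f = foldr _⊕₂_ (bot , bot) (map f (allFin n))

-- Since no E₁-edge follows an E₂-edge, every u–v path is an E₁-path from u to some vᵢ
-- followed by an E₂-path from vᵢ to v, so the u–v paths are exactly the concatenations
-- of a path of 𝒫ᵢ with a path of 𝒬ᵢ, over all i.  Hence an edge of E₁ lies on all u–v
-- paths iff it lies on all paths of every 𝒫ᵢ with 𝒬ᵢ ≠ ∅, and dually for E₂.  The first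
-- component of X is ⊥, a single edge e or ⊤ according as the terms repr_L(𝒫ᵢ) with
-- 𝒫ᵢ, 𝒬ᵢ ≠ ∅ are absent, all equal to e, or not; in the middle case e lies on all u–v
-- paths.  For (e) the converse is needed: if an E₁-edge (x,y) lies on all u–v paths,
-- then all the families 𝒫ᵢ that matter share the mandatory edge (x,y), and two path
-- families out of u sharing a mandatory edge have the same leftmost mandatory edge, so
-- X₁ is that edge rather than ⊤.

module Submission where

open import Defs
open import Data.Nat using (ℕ)
import Data.Nat.Properties as ℕ
open import Data.Fin using (Fin; _≤_; _<_)
import Data.Fin.Properties as Fin
open import Data.Bool using (true; false)
import Data.Bool as Bool
open import Data.Bool.Properties using (∧-conicalˡ; ∧-conicalʳ; not-¬)
open import Data.Product using (_×_; _,_; Σ; ∃; proj₁; proj₂)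
open import Data.Sum using (_⊎_; inj₁; inj₂)
import Data.Sum as Sum
open import Data.Empty using (⊥; ⊥-elim)
open import Data.List using (List; []; _∷_; foldr; map; allFin)
open import Data.List.Relation.Unary.All as All using (All; []; _∷_)
open import Data.List.Membership.Propositional.Properties using (∈-allFin)
open import Axiom.UniquenessOfIdentityProofs using (module Decidable⇒UIP)
open import Function using (_∘_)
open import Function.Bundles using (_⇔_; mk⇔; Equivalence)
open import Relation.Nullary using (¬_; Dec; yes; no; contradiction)
open import Relation.Nullary.Decidable using (_×-dec_; map′)
open import Relation.Binary.PropositionalEquality using (_≡_; refl; sym; trans; cong; cong₂; subst)

open Equivalence using (to; from)

module _ {n : ℕ} {H : Graph n} where

  infixr 5 _++_
  _++_ : ∀ {a b c} → Path H a b → Path H b c → Path H a c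
  here     ++ q = q
  step h p ++ q = step h (p ++ q)

  OnPath-++⁻ : ∀ {a b c x y} (p : Path H a b) (q : Path H b c) →
               OnPath x y (p ++ q) → OnPath x y p ⊎ OnPath x y q
  OnPath-++⁻ here       q o        = inj₂ o
  OnPath-++⁻ (step h p) q (inj₁ e) = inj₁ (inj₁ e)
  OnPath-++⁻ (step h p) q (inj₂ o) = Sum.map₁ inj₂ (OnPath-++⁻ p q o)

  OnPath-++⁺ˡ : ∀ {a b c x y} (p : Path H a b) (q : Path H b c) →
                OnPath x y p → OnPath x y (p ++ q)
  OnPath-++⁺ˡ (step h p) q (inj₁ e) = inj₁ e
  OnPath-++⁺ˡ (step h p) q (inj₂ o) = inj₂ (OnPath-++⁺ˡ p q o)

  OnPath-++⁺ʳ : ∀ {a b c x y} (p : Path H a b) (q : Path H b c) →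
                OnPath x y q → OnPath x y (p ++ q)
  OnPath-++⁺ʳ here       q o = o
  OnPath-++⁺ʳ (step h p) q o = inj₂ (OnPath-++⁺ʳ p q o)

  OnPath⇒edge : ∀ {a b x y} (p : Path H a b) → OnPath x y p → H x y ≡ true
  OnPath⇒edge (step h p) (inj₁ (refl , refl)) = h
  OnPath⇒edge (step h p) (inj₂ o)             = OnPath⇒edge p o

  splitAt : ∀ {a b x y} (p : Path H a b) → OnPath x y p →
            Σ (Path H a x) λ p₁ → Σ (H x y ≡ true) λ h → Σ (Path H y b) λ p₂ →
              p ≡ p₁ ++ step h p₂
  splitAt (step h p) (inj₁ (refl , refl)) = here , h , p , refl
  splitAt (step h p) (inj₂ o) with splitAt p o
  ... | p₁ , h′ , p₂ , eq = step h p₁ , h′ , p₂ , cong (step h) eq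

module _ {n : ℕ} {H H′ : Graph n} (H⊆H′ : SubGraph H H′) where

  mapPath : ∀ {a b} → Path H a b → Path H′ a b
  mapPath here               = here
  mapPath (step {a} {b} h p) = step (H⊆H′ a b h) (mapPath p)

  OnPath-map⁺ : ∀ {a b x y} (p : Path H a b) → OnPath x y p → OnPath x y (mapPath p)
  OnPath-map⁺ (step h p) (inj₁ e) = inj₁ e
  OnPath-map⁺ (step h p) (inj₂ o) = inj₂ (OnPath-map⁺ p o)

  OnPath-map⁻ : ∀ {a b x y} (p : Path H a b) → OnPath x y (mapPath p) → OnPath x y p
  OnPath-map⁻ (step h p) (inj₁ e) = inj₁ e
  OnPath-map⁻ (step h p) (inj₂ o) = inj₂ (OnPath-map⁻ p o)

  TopologicalOrder-⊆ : TopologicalOrder H′ → TopologicalOrder H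
  TopologicalOrder-⊆ topo x y h = topo x y (H⊆H′ x y h)

module Monotone {n : ℕ} {H : Graph n} (mono : TopologicalOrder H) where

  source≤target : ∀ {a b} → Path H a b → a ≤ b
  source≤target here               = ℕ.≤-refl
  source≤target (step {a} {b} h p) = ℕ.<⇒≤ (ℕ.<-≤-trans (mono a b h) (source≤target p))

  source≤tail : ∀ {a b x y} (p : Path H a b) → OnPath x y p → a ≤ x
  source≤tail p o with splitAt p o
  ... | p₁ , _ , _ , _ = source≤target p₁

  tail<target : ∀ {a b x y} (p : Path H a b) → OnPath x y p → x < b
  tail<target p o with splitAt p o
  ... | _ , h , p₂ , _ = ℕ.<-≤-trans (mono _ _ h) (source≤target p₂)

  OnPath-head-unique : ∀ {a b x y y′} (p : Path H a b) →
                       OnPath x y p → OnPath x y′ p → y ≡ y′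
  OnPath-head-unique (step h p) (inj₁ (refl , refl)) (inj₁ (refl , refl)) = refl
  OnPath-head-unique (step h p) (inj₁ (refl , refl)) (inj₂ o) =
    ⊥-elim (ℕ.<⇒≱ (mono _ _ h) (source≤tail p o))
  OnPath-head-unique (step h p) (inj₂ o) (inj₁ (refl , refl)) =
    ⊥-elim (ℕ.<⇒≱ (mono _ _ h) (source≤tail p o))
  OnPath-head-unique (step h p) (inj₂ o) (inj₂ o′) = OnPath-head-unique p o o′

  -- Splice the part before (x,y) of a u–j path with the part after (x,y) of a u–i path.
  OnAll-transferˡ : ∀ {u i j x y a b} → Path H u i → OnAll H u i x y → OnAll H u j x y →
                    OnAll H u i a b → a ≤ x → OnAll H u j a b
  OnAll-transferˡ q xyᵢ xyⱼ abᵢ a≤x p with splitAt p (xyⱼ p) | splitAt q (xyᵢ q)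
  ... | p₁ , h , p₂ , refl | _ , _ , q₂ , _ with OnPath-++⁻ p₁ (step h q₂) (abᵢ (p₁ ++ step h q₂))
  ... | inj₁ o        = OnPath-++⁺ˡ p₁ (step h p₂) o
  ... | inj₂ (inj₁ e) = OnPath-++⁺ʳ p₁ (step h p₂) (inj₁ e)
  ... | inj₂ (inj₂ o) = ⊥-elim (ℕ.<⇒≱ (mono _ _ h) (ℕ.≤-trans (source≤tail q₂ o) a≤x))

  OnAll-transferʳ : ∀ {v i j x y a b} → Path H i v → OnAll H i v x y → OnAll H j v x y →
                    OnAll H i v a b → x ≤ a → OnAll H j v a b
  OnAll-transferʳ q xyᵢ xyⱼ abᵢ x≤a p with splitAt p (xyⱼ p) | splitAt q (xyᵢ q)
  ... | p₁ , h , p₂ , refl | q₁ , _ , _ , _ with OnPath-++⁻ q₁ (step h p₂) (abᵢ (q₁ ++ step h p₂))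
  ... | inj₁ o = ⊥-elim (ℕ.<⇒≱ (tail<target q₁ o) x≤a)
  ... | inj₂ o = OnPath-++⁺ʳ p₁ (step h p₂) o

  IsReprL-unique : ∀ {u i j x y c d} → Path H u i → Path H u j →
                   IsReprL H u i c → IsReprL H u j d →
                   OnAll H u i x y → OnAll H u j x y → c ≡ d
  IsReprL-unique {c = bot} pᵢ _ rᵢ _ _ _ = ⊥-elim (rᵢ pᵢ)
  IsReprL-unique {d = bot} _ pⱼ _ rⱼ _ _ = ⊥-elim (rⱼ pⱼ)
  IsReprL-unique {x = x} {y} {c = top} _ _ (_ , none) _ xyᵢ _ = ⊥-elim (none x y xyᵢ)
  IsReprL-unique {x = x} {y} {d = top} _ _ _ (_ , none) _ xyⱼ = ⊥-elim (none x y xyⱼ)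
  IsReprL-unique {u} {i} {j} {x} {y} {edge a b} {edge a′ b′}
                 pᵢ pⱼ (_ , abᵢ , minᵢ) (_ , a′b′ⱼ , minⱼ) xyᵢ xyⱼ =
    cong₂ edge a≡a′ (OnPath-head-unique pⱼ (subst (λ z → OnPath z b pⱼ) a≡a′ (abⱼ pⱼ)) (a′b′ⱼ pⱼ))
    where
      abⱼ : OnAll H u j a b
      abⱼ = OnAll-transferˡ pᵢ xyᵢ xyⱼ abᵢ (minᵢ x y xyᵢ)
      a≡a′ : a ≡ a′
      a≡a′ = Fin.≤-antisym
               (minᵢ a′ b′ (OnAll-transferˡ pⱼ xyⱼ xyᵢ a′b′ⱼ (minⱼ x y xyⱼ)))
               (minⱼ a b abⱼ)

  IsReprR-unique : ∀ {v i j x y c d} → Path H i v → Path H j v →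
                   IsReprR H i v c → IsReprR H j v d →
                   OnAll H i v x y → OnAll H j v x y → c ≡ d
  IsReprR-unique {c = bot} pᵢ _ rᵢ _ _ _ = ⊥-elim (rᵢ pᵢ)
  IsReprR-unique {d = bot} _ pⱼ _ rⱼ _ _ = ⊥-elim (rⱼ pⱼ)
  IsReprR-unique {x = x} {y} {c = top} _ _ (_ , none) _ xyᵢ _ = ⊥-elim (none x y xyᵢ)
  IsReprR-unique {x = x} {y} {d = top} _ _ _ (_ , none) _ xyⱼ = ⊥-elim (none x y xyⱼ)
  IsReprR-unique {v} {i} {j} {x} {y} {edge a b} {edge a′ b′}
                 pᵢ pⱼ (_ , abᵢ , maxᵢ) (_ , a′b′ⱼ , maxⱼ) xyᵢ xyⱼ =
    cong₂ edge a≡a′ (OnPath-head-unique pⱼ (subst (λ z → OnPath z b pⱼ) a≡a′ (abⱼ pⱼ)) (a′b′ⱼ pⱼ))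
    where
      abⱼ : OnAll H j v a b
      abⱼ = OnAll-transferʳ pᵢ xyᵢ xyⱼ abᵢ (maxᵢ x y xyᵢ)
      a≡a′ : a ≡ a′
      a≡a′ = Fin.≤-antisym (maxⱼ a b abⱼ)
               (maxᵢ a′ b′ (OnAll-transferʳ pⱼ xyⱼ xyᵢ a′b′ⱼ (maxⱼ x y xyⱼ)))

module EdgeSplit {n : ℕ} {E E₁ : Graph n} (split : IsEdgeSplit E E₁) where

  open Decidable⇒UIP Bool._≟_ using (≡-irrelevant)

  E₂ : Graph n
  E₂ = complement E E₁

  E₁⊆E : SubGraph E₁ E
  E₁⊆E = proj₁ split

  E₂⊆E : SubGraph E₂ E
  E₂⊆E x y = ∧-conicalˡ (E x y) _

  E₂-intro : ∀ {x y} → E x y ≡ true → E₁ x y ≡ false → E₂ x y ≡ true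
  E₂-intro xy∈E xy∉E₁ rewrite xy∈E | xy∉E₁ = refl

  E₁∩E₂-disjoint : ∀ {x y} → E₁ x y ≡ true → E₂ x y ≡ true → ⊥
  E₁∩E₂-disjoint {x} {y} xy∈E₁ xy∈E₂ =
    not-¬ (sym xy∈E₁) (sym (∧-conicalʳ (E x y) _ xy∈E₂))

  join : ∀ {a i b} → Path E₁ a i → Path E₂ i b → Path E a b
  join p q = mapPath E₁⊆E p ++ mapPath E₂⊆E q

  OnPath-join⁻ : ∀ {a i b x y} (p : Path E₁ a i) (q : Path E₂ i b) →
                 OnPath x y (join p q) → OnPath x y p ⊎ OnPath x y q
  OnPath-join⁻ p q o =
    Sum.map (OnPath-map⁻ E₁⊆E p) (OnPath-map⁻ E₂⊆E q) (OnPath-++⁻ (mapPath E₁⊆E p) _ o)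

  OnPath-join⁺ˡ : ∀ {a i b x y} (p : Path E₁ a i) (q : Path E₂ i b) →
                  OnPath x y p → OnPath x y (join p q)
  OnPath-join⁺ˡ p q o = OnPath-++⁺ˡ _ (mapPath E₂⊆E q) (OnPath-map⁺ E₁⊆E p o)

  OnPath-join⁺ʳ : ∀ {a i b x y} (p : Path E₁ a i) (q : Path E₂ i b) →
                  OnPath x y q → OnPath x y (join p q)
  OnPath-join⁺ʳ p q o = OnPath-++⁺ʳ (mapPath E₁⊆E p) _ (OnPath-map⁺ E₂⊆E q o)

  decompose : ∀ {a b} (s : Path E a b) →
              ∃ λ i → Σ (Path E₁ a i) λ p → Σ (Path E₂ i b) λ q → s ≡ join p q
  decompose here = _ , here , here , refl
  decompose (step {a} {b} h s) with decompose s | E₁ a b in ab∈E₁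
  ... | i , p , q , refl | true =
    i , step ab∈E₁ p , q , cong (λ h → step h (join p q)) (≡-irrelevant _ _)
  ... | _ , here , q , refl | false =
    a , here , step (E₂-intro h ab∈E₁) q , cong (λ h → step h (join here q)) (≡-irrelevant _ _)
  ... | _ , step bc∈E₁ _ , _ , _ | false = ⊥-elim (proj₂ split a b _ (E₂-intro h ab∈E₁) bc∈E₁)

module _ {n : ℕ} where

  -- The flat order on E⁺ (⊥ below every edge, ⊤ above); ⊕ is its join.
  infix 4 _⊑_ _⊑₂_
  data _⊑_ : E⁺ {n} → E⁺ {n} → Set where
    bot⊑      : ∀ {c} → bot ⊑ c
    ⊑top      : ∀ {c} → c ⊑ top
    edge⊑edge : ∀ {x y} → edge x y ⊑ edge x y

  ⊑-reflexive : ∀ {c d : E⁺ {n}} → c ≡ d → c ⊑ d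
  ⊑-reflexive {bot}      refl = bot⊑
  ⊑-reflexive {top}      refl = ⊑top
  ⊑-reflexive {edge _ _} refl = edge⊑edge

  ⊕-⊑⁻ : ∀ (a b : E⁺ {n}) {c} → a ⊕ b ⊑ c → a ⊑ c × b ⊑ c
  ⊕-⊑⁻ a          bot        le   = le , bot⊑
  ⊕-⊑⁻ bot        top        le   = bot⊑ , le
  ⊕-⊑⁻ bot        (edge _ _) le   = bot⊑ , le
  ⊕-⊑⁻ top        top        ⊑top = ⊑top , ⊑top
  ⊕-⊑⁻ top        (edge _ _) ⊑top = ⊑top , ⊑top
  ⊕-⊑⁻ (edge _ _) top        ⊑top = ⊑top , ⊑top
  ⊕-⊑⁻ (edge x y) (edge x′ y′) le with x Fin.≟ x′ | y Fin.≟ y′ | le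
  ... | yes refl | yes refl | le′  = le′ , le′
  ... | yes _    | no _     | ⊑top = ⊑top , ⊑top
  ... | no _     | _        | ⊑top = ⊑top , ⊑top

  ⊕-⊑⁺ : ∀ {a b c : E⁺ {n}} → a ⊑ c → b ⊑ c → a ⊕ b ⊑ c
  ⊕-⊑⁺ _         ⊑top      = ⊑top
  ⊕-⊑⁺ ⊑top      _         = ⊑top
  ⊕-⊑⁺ bot⊑      bot⊑      = bot⊑
  ⊕-⊑⁺ bot⊑      edge⊑edge = edge⊑edge
  ⊕-⊑⁺ edge⊑edge bot⊑      = edge⊑edge
  ⊕-⊑⁺ (edge⊑edge {x} {y}) edge⊑edge with x Fin.≟ x | y Fin.≟ y
  ... | yes _ | yes _   = edge⊑edge
  ... | yes _ | no y≢y  = contradiction refl y≢y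
  ... | no x≢x | _      = contradiction refl x≢x

  _⊑₂_ : E⁺ {n} × E⁺ {n} → E⁺ {n} × E⁺ {n} → Set
  (a , b) ⊑₂ (c , d) = a ⊑ c × b ⊑ d

  ⊑₂-⊥ : ∀ {c} → c ⊑₂ (bot , bot) → c ≡ (bot , bot)
  ⊑₂-⊥ (bot⊑ , bot⊑) = refl

  foldr-⊕₂-⊑ : ∀ {A : Set} (f : A → E⁺ × E⁺) (xs : List A) {c} →
               foldr _⊕₂_ (bot , bot) (map f xs) ⊑₂ c ⇔ All (λ i → f i ⊑₂ c) xs
  foldr-⊕₂-⊑ f xs = mk⇔ (bound⇒all xs) (all⇒bound xs)
    where
      bound⇒all : ∀ xs {c} → foldr _⊕₂_ (bot , bot) (map f xs) ⊑₂ c → All (λ i → f i ⊑₂ c) xs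
      bound⇒all []       _         = []
      bound⇒all (x ∷ xs) (le₁ , le₂) with ⊕-⊑⁻ _ _ le₁ | ⊕-⊑⁻ _ _ le₂
      ... | x₁ , xs₁ | x₂ , xs₂ = (x₁ , x₂) ∷ bound⇒all xs (xs₁ , xs₂)
      all⇒bound : ∀ xs {c} → All (λ i → f i ⊑₂ c) xs → foldr _⊕₂_ (bot , bot) (map f xs) ⊑₂ c
      all⇒bound []       []                   = bot⊑ , bot⊑
      all⇒bound (x ∷ xs) ((x₁ , x₂) ∷ bounds) =
        let (xs₁ , xs₂) = all⇒bound xs bounds in ⊕-⊑⁺ x₁ xs₁ , ⊕-⊑⁺ x₂ xs₂

  ⨁-⊑ : ∀ (f : Fin n → E⁺ × E⁺) {c} → ⨁ f ⊑₂ c ⇔ (∀ i → f i ⊑₂ c)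
  ⨁-⊑ f = mk⇔ (λ le i → All.lookup (to (foldr-⊕₂-⊑ f (allFin n)) le) (∈-allFin i))
               (λ bounds → from (foldr-⊕₂-⊑ f (allFin n)) (All.tabulate λ {i} _ → bounds i))

  -- c encodes repr of the family of all H-paths a → b, forgetting which edge of it repr_L
  -- or repr_R picks.
  IsRepr : Graph n → Fin n → Fin n → E⁺ {n} → Set
  IsRepr H a b bot        = ReprIsUniverse H a b
  IsRepr H a b top        = ReprIsEmpty H a b
  IsRepr H a b (edge x y) = InRepr H a b x y

  IsReprL⇒IsRepr : ∀ {H a b c} → IsReprL H a b c → IsRepr H a b c
  IsReprL⇒IsRepr {c = bot}      r              = r
  IsReprL⇒IsRepr {c = top}      r              = r
  IsReprL⇒IsRepr {c = edge _ _} (p , onAll , _) = p , onAll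

  IsReprR⇒IsRepr : ∀ {H a b c} → IsReprR H a b c → IsRepr H a b c
  IsReprR⇒IsRepr {c = bot}      r              = r
  IsReprR⇒IsRepr {c = top}      r              = r
  IsReprR⇒IsRepr {c = edge _ _} (p , onAll , _) = p , onAll

  IsRepr-dec : ∀ {H a b c} → IsRepr H a b c → Dec (Path H a b)
  IsRepr-dec {c = bot}      r = no r
  IsRepr-dec {c = top}      r = yes (proj₁ r)
  IsRepr-dec {c = edge _ _} r = yes (proj₁ r)

  IsRepr-⊑bot : ∀ {H a b c} → IsRepr H a b c → c ⊑ bot → ¬ Path H a b
  IsRepr-⊑bot r bot⊑ = r

  IsRepr-⊑edge : ∀ {H a b c x y} → IsRepr H a b c → c ⊑ edge x y → OnAll H a b x y
  IsRepr-⊑edge r bot⊑      p = ⊥-elim (r p)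
  IsRepr-⊑edge r edge⊑edge   = proj₂ r

  IsRepr-top⊑ : ∀ {H a b c x y} → IsRepr H a b c → top ⊑ c → ¬ OnAll H a b x y
  IsRepr-top⊑ {x = x} {y} r ⊑top = proj₂ r x y

  ⊗-⊑₂ : ∀ {H₁ H₂ a m b c d e} → IsRepr H₁ a m c → IsRepr H₂ m b d →
         c ⊗ d ⊑₂ e ⇔ (Path H₁ a m → Path H₂ m b → (c , d) ⊑₂ e)
  ⊗-⊑₂ {c = bot} r _ = mk⇔ (λ _ p _ → ⊥-elim (r p)) (λ _ → bot⊑ , bot⊑)
  ⊗-⊑₂ {c = top}      {bot} _ r′ = mk⇔ (λ _ _ q → ⊥-elim (r′ q)) (λ _ → bot⊑ , bot⊑)
  ⊗-⊑₂ {c = edge _ _} {bot} _ r′ = mk⇔ (λ _ _ q → ⊥-elim (r′ q)) (λ _ → bot⊑ , bot⊑)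
  ⊗-⊑₂ {c = top}      {top}      (p , _) (q , _) = mk⇔ (λ le _ _ → le) (λ h → h p q)
  ⊗-⊑₂ {c = top}      {edge _ _} (p , _) (q , _) = mk⇔ (λ le _ _ → le) (λ h → h p q)
  ⊗-⊑₂ {c = edge _ _} {top}      (p , _) (q , _) = mk⇔ (λ le _ _ → le) (λ h → h p q)
  ⊗-⊑₂ {c = edge _ _} {edge _ _} (p , _) (q , _) = mk⇔ (λ le _ _ → le) (λ h → h p q)

module SplitSum {n : ℕ} (E E₁ : Graph n) (topo : TopologicalOrder E) (split : IsEdgeSplit E E₁)
                (u v : Fin n) (rL rR : Fin n → E⁺ {n})
                (isReprL : ∀ i → IsReprL E₁ u i (rL i))
                (isReprR : ∀ i → IsReprR (complement E E₁) i v (rR i)) where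

  open EdgeSplit split

  X : E⁺ {n} × E⁺ {n}
  X = ⨁ (λ i → rL i ⊗ rR i)

  reprL : ∀ i → IsRepr E₁ u i (rL i)
  reprL i = IsReprL⇒IsRepr (isReprL i)

  reprR : ∀ i → IsRepr E₂ i v (rR i)
  reprR i = IsReprR⇒IsRepr (isReprR i)

  X-⊑ : ∀ {c} → X ⊑₂ c ⇔ (∀ i → Path E₁ u i → Path E₂ i v → (rL i , rR i) ⊑₂ c)
  X-⊑ = mk⇔ (λ le i → to (contribution i) (to (⨁-⊑ _) le i))
             (λ bounds → from (⨁-⊑ _) λ i → from (contribution i) (bounds i))
    where
      contribution : ∀ i {c} → rL i ⊗ rR i ⊑₂ c ⇔ (Path E₁ u i → Path E₂ i v → (rL i , rR i) ⊑₂ c)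
      contribution i = ⊗-⊑₂ (reprL i) (reprR i)

  path? : Dec (Path E u v)
  path? = map′ (λ (_ , p , q) → join p q) (λ s → let (i , p , q , _) = decompose s in i , p , q)
               (Fin.any? λ i → IsRepr-dec (reprL i) ×-dec IsRepr-dec (reprR i))

  noPath⇒X≡⊥ : ReprIsUniverse E u v → X ≡ (bot , bot)
  noPath⇒X≡⊥ noPath = ⊑₂-⊥ (from X-⊑ λ _ p q → ⊥-elim (noPath (join p q)))

  fst≡nonbot⇒path : ∀ {c} → proj₁ X ≡ c → ¬ c ≡ bot → Path E u v
  fst≡nonbot⇒path X₁≡c c≢⊥ with path?
  ... | yes s      = s
  ... | no noPath = ⊥-elim (c≢⊥ (trans (sym X₁≡c) (cong proj₁ (noPath⇒X≡⊥ noPath))))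

  snd≡nonbot⇒path : ∀ {c} → proj₂ X ≡ c → ¬ c ≡ bot → Path E u v
  snd≡nonbot⇒path X₂≡c c≢⊥ with path?
  ... | yes s      = s
  ... | no noPath = ⊥-elim (c≢⊥ (trans (sym X₂≡c) (cong proj₂ (noPath⇒X≡⊥ noPath))))

  fst≡bot⇒noPath : proj₁ X ≡ bot → ReprIsUniverse E u v
  fst≡bot⇒noPath X₁≡⊥ s with decompose s
  ... | i , p , q , _ =
    IsRepr-⊑bot (reprL i) (proj₁ (to X-⊑ (⊑-reflexive X₁≡⊥ , ⊑top) i p q)) p

  snd≡bot⇒noPath : proj₂ X ≡ bot → ReprIsUniverse E u v
  snd≡bot⇒noPath X₂≡⊥ s with decompose s
  ... | i , p , q , _ =
    IsRepr-⊑bot (reprR i) (proj₂ (to X-⊑ (⊑top , ⊑-reflexive X₂≡⊥) i p q)) q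

  fst≡edge⇒InRepr : ∀ {x y} → proj₁ X ≡ edge x y → InRepr E u v x y
  fst≡edge⇒InRepr {x} {y} X₁≡e = fst≡nonbot⇒path X₁≡e (λ ()) , onAll
    where
      onAll : OnAll E u v x y
      onAll s with decompose s
      ... | i , p , q , refl = OnPath-join⁺ˡ p q (IsRepr-⊑edge (reprL i)
                                 (proj₁ (to X-⊑ (⊑-reflexive X₁≡e , ⊑top) i p q)) p)

  snd≡edge⇒InRepr : ∀ {x y} → proj₂ X ≡ edge x y → InRepr E u v x y
  snd≡edge⇒InRepr {x} {y} X₂≡e = snd≡nonbot⇒path X₂≡e (λ ()) , onAll
    where
      onAll : OnAll E u v x y
      onAll s with decompose s
      ... | i , p , q , refl = OnPath-join⁺ʳ p q (IsRepr-⊑edge (reprR i)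
                                 (proj₂ (to X-⊑ (⊑top , ⊑-reflexive X₂≡e) i p q)) q)

  module M₁ = Monotone (TopologicalOrder-⊆ E₁⊆E topo)
  module M₂ = Monotone (TopologicalOrder-⊆ E₂⊆E topo)

  fst≡top⇒¬OnAll : ∀ {x y} → proj₁ X ≡ top → E₁ x y ≡ true → ¬ OnAll E u v x y
  fst≡top⇒¬OnAll {x} {y} X₁≡⊤ xy∈E₁ xy with decompose (fst≡nonbot⇒path X₁≡⊤ λ ())
  ... | i₀ , p₀ , q₀ , _ =
    IsRepr-top⊑ (reprL i₀) (subst (_⊑ rL i₀) X₁≡⊤ (proj₁ X⊑rL₀)) (mandatory q₀)
    where
      mandatory : ∀ {i} → Path E₂ i v → OnAll E₁ u i x y
      mandatory q p with OnPath-join⁻ p q (xy (join p q))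
      ... | inj₁ o = o
      ... | inj₂ o = ⊥-elim (E₁∩E₂-disjoint xy∈E₁ (OnPath⇒edge q o))
      X⊑rL₀ : X ⊑₂ (rL i₀ , top)
      X⊑rL₀ = from X-⊑ λ i p q →
        ⊑-reflexive (M₁.IsReprL-unique p p₀ (isReprL i) (isReprL i₀) (mandatory q) (mandatory q₀)) , ⊑top

  snd≡top⇒¬OnAll : ∀ {x y} → proj₂ X ≡ top → E₁ x y ≡ false → ¬ OnAll E u v x y
  snd≡top⇒¬OnAll {x} {y} X₂≡⊤ xy∉E₁ xy with decompose (snd≡nonbot⇒path X₂≡⊤ λ ())
  ... | i₀ , p₀ , q₀ , _ =
    IsRepr-top⊑ (reprR i₀) (subst (_⊑ rR i₀) X₂≡⊤ (proj₂ X⊑rR₀)) (mandatory p₀)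
    where
      mandatory : ∀ {i} → Path E₁ u i → OnAll E₂ i v x y
      mandatory p q with OnPath-join⁻ p q (xy (join p q))
      ... | inj₁ o = contradiction (trans (sym (OnPath⇒edge p o)) xy∉E₁) λ ()
      ... | inj₂ o = o
      X⊑rR₀ : X ⊑₂ (top , rR i₀)
      X⊑rR₀ = from X-⊑ λ i p q →
        ⊑top , ⊑-reflexive (M₂.IsReprR-unique q q₀ (isReprR i) (isReprR i₀) (mandatory p) (mandatory p₀))

  X≡⊤⇒ReprIsEmpty : X ≡ (top , top) → ReprIsEmpty E u v
  X≡⊤⇒ReprIsEmpty X≡⊤ = fst≡nonbot⇒path (cong proj₁ X≡⊤) (λ ()) , noneOnAll
    where
      noneOnAll : ∀ x y → ¬ OnAll E u v x y
      noneOnAll x y with E₁ x y in xy∈?E₁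
      ... | true  = fst≡top⇒¬OnAll (cong proj₁ X≡⊤) xy∈?E₁
      ... | false = snd≡top⇒¬OnAll (cong proj₂ X≡⊤) xy∈?E₁

  ReprIsEmpty⇒X≡⊤ : ReprIsEmpty E u v → X ≡ (top , top)
  ReprIsEmpty⇒X≡⊤ (s , none) = cong₂ _,_ fst≡top snd≡top
    where
      fst≡top : proj₁ X ≡ top
      fst≡top with proj₁ X in X₁≡
      ... | bot      = ⊥-elim (fst≡bot⇒noPath X₁≡ s)
      ... | top      = refl
      ... | edge x y = ⊥-elim (none x y (proj₂ (fst≡edge⇒InRepr X₁≡)))
      snd≡top : proj₂ X ≡ top
      snd≡top with proj₂ X in X₂≡
      ... | bot      = ⊥-elim (snd≡bot⇒noPath X₂≡ s)
      ... | top      = refl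
      ... | edge x y = ⊥-elim (none x y (proj₂ (snd≡edge⇒InRepr X₂≡)))

lemma3 : ∀ {n : ℕ} (E E₁ : Graph n) → TopologicalOrder E → IsEdgeSplit E E₁ →
    (u v : Fin n) → (rL rR : Fin n → E⁺) →
    (∀ i → IsReprL E₁ u i (rL i)) →
    (∀ i → IsReprR (complement E E₁) i v (rR i)) →
    let X = ⨁ (λ i → rL i ⊗ rR i) in
    ((X ≡ (bot , bot)) ⇔ ReprIsUniverse E u v) ×
    (∀ x₁ y₁ → X ≡ (edge x₁ y₁ , top) → InRepr E u v x₁ y₁) ×
    (∀ x₂ y₂ → X ≡ (top , edge x₂ y₂) → InRepr E u v x₂ y₂) ×
    (∀ x₁ y₁ x₂ y₂ → X ≡ (edge x₁ y₁ , edge x₂ y₂) →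
      InRepr E u v x₁ y₁ × InRepr E u v x₂ y₂) ×
    ((X ≡ (top , top)) ⇔ ReprIsEmpty E u v)
lemma3 E E₁ topo split u v rL rR isReprL isReprR =
    mk⇔ (fst≡bot⇒noPath ∘ cong proj₁) noPath⇒X≡⊥
  , (λ _ _ X≡ → fst≡edge⇒InRepr (cong proj₁ X≡))
  , (λ _ _ X≡ → snd≡edge⇒InRepr (cong proj₂ X≡))
  , (λ _ _ _ _ X≡ → fst≡edge⇒InRepr (cong proj₁ X≡) , snd≡edge⇒InRepr (cong proj₂ X≡))
  , mk⇔ X≡⊤⇒ReprIsEmpty ReprIsEmpty⇒X≡⊤
  where open SplitSum E E₁ topo split u v rL rR isReprL isReprR
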